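{- Let $\omega=(1+\sqrt{ -3})/2$ and $Q=\{x+y\omega: x,y\in\mathbb{Z},\ x>0,\ y>0\}$. Suppose the Eisenstein Goldbach conjecture holds: every Eisenstein integer $a+b\omega$ with integers $a>1$, $b>1$, other than $3+109\omega$, $109+3\omega$, $3+121\omega$, $121+3\omega$, is a sum of two Eisenstein primes lying in $Q$. Then there are infinitely many positive integers $x$ such that $x^2+x+1$ is a rational prime.
   Context: The Eisenstein integers are the ring $\mathbb{Z}[\omega]=\{a+b\omega: a,b\in\mathbb{Z}\}$ with $\omega=(1+\sqrt{ -3})/2$, and norm $N(a+b\omega)=a^2+ab+b^2$. An Eisenstein prime is an irreducible element of $\mathbb{Z}[\omega]$. The two summands need not be distinct. -}

module Defs where

open import Data.Integer using (ℤ; +_; _+_; _*_; -_; _-_; _>_)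
open import Data.Product using (_×_)
open import Relation.Binary.PropositionalEquality using (_≡_)
open import Algebra.Bundles.Raw using (RawSemiring)
import Algebra.Definitions.RawSemiring as RSDefs

-- An Eisenstein integer  re + im·ω  with ω = (1+√-3)/2, so ω² = ω - 1.
record 𝔼 : Set where
  constructor _+_ω
  field
    re : ℤ
    im : ℤ
open 𝔼 public

infixl 6 _+ᴱ_
infixl 7 _*ᴱ_

_+ᴱ_ : 𝔼 → 𝔼 → 𝔼
(a + b ω) +ᴱ (c + d ω) = (a + c) + (b + d) ω

-- (a + bω)(c + dω) = ac + (ad + bc)ω + bd ω² = (ac - bd) + (ad + bc + bd)ω
_*ᴱ_ : 𝔼 → 𝔼 → 𝔼
(a + b ω) *ᴱ (c + d ω) = (a * c - b * d) + (a * d + b * c + b * d) ω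

0ᴱ 1ᴱ : 𝔼
0ᴱ = (+ 0) + (+ 0) ω
1ᴱ = (+ 1) + (+ 0) ω

𝔼-rawSemiring : RawSemiring _ _
𝔼-rawSemiring = record
  { Carrier = 𝔼
  ; _≈_ = _≡_
  ; _+_ = _+ᴱ_
  ; _*_ = _*ᴱ_
  ; 0# = 0ᴱ
  ; 1# = 1ᴱ
  }

-- Eisenstein prime = irreducible element of ℤ[ω] (stdlib notion: not a unit,
-- and any factorisation has a unit factor; 0 is excluded automatically since 0 = 0·2).
EisensteinPrime : 𝔼 → Set
EisensteinPrime = RSDefs.Irreducible 𝔼-rawSemiring

InQ : 𝔼 → Set
InQ z = (re z > + 0) × (im z > + 0)

module Submission where

-- Apply the Eisenstein Goldbach hypothesis to 2 + (N+N+2)ω.  Both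
-- summands lie in Q, so both have real part 1: they are 1 + y₁ω and 1 + y₂ω
-- with y₁ + y₂ = N+N+2, hence one of y₁, y₂ exceeds N.  It remains to show
-- that 1 + yω irreducible forces its norm y² + y + 1 to be a rational prime.
--
-- For that, let d be a proper divisor of n = y² + y + 1, with n = d·e.  By
-- strong induction we may assume d is not a square, so s² < d < (s+1)².
-- Thue's lemma (pigeonhole on the (s+1)² pairs (u,v) ∈ [0,s]²) gives
-- (a,b) ≠ (0,0) with |a|,|b| ≤ s and a·y ≡ b (mod d).  Then d divides
-- N(a+bω) ≡ a²(y²+y+1), and 0 < N(a+bω) ≤ 3s² < 3d, so N(a+bω) is d or 2d.
-- The value 2d is impossible by parity (n is odd), and N(a+bω) = d yields an
-- explicit factorisation 1 + yω = (a+bω)·γ with N(γ) = e; irreducibility then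
-- forces d = 1 or e = 1.

open import Defs
open import Data.Nat using (ℕ; _<_)
open import Data.Nat.Primality using (Prime)
open import Data.Integer using (ℤ; +_; _>_)
open import Data.Product using (_×_; ∃-syntax)
open import Relation.Nullary using (¬_)
open import Relation.Binary.PropositionalEquality using (_≡_)

open import Data.Nat as ℕ using (suc; zero; z≤n; s≤s; NonZero)
import Data.Nat.Properties as ℕP
open import Data.Nat.Divisibility using (divides; _∣_)
open import Data.Nat.Induction using (<-rec)
open import Data.Nat.Primality using (prime; composite)
open import Data.Integer as ℤ using (-[1+_]; _+_; _*_; _-_; ∣_∣; +<+)
import Data.Integer.Properties as ℤP
open import Data.Integer.DivMod using (_%ℕ_; _/ℕ_; a≡a%ℕn+[a/ℕn]*n; n%ℕd<d)
open import Data.Integer.Tactic.RingSolver using (solve-∀)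
open import Data.Fin as Fin using (Fin; toℕ; fromℕ<; remQuot; combine)
import Data.Fin.Properties as FinP
open import Data.Product using (_,_; proj₁; proj₂; uncurry)
open import Data.Sum using (_⊎_; inj₁; inj₂; [_,_])
import Data.Sum as Sum
open import Data.Empty using (⊥; ⊥-elim)
open import Relation.Nullary using (yes; no)
open import Relation.Binary.PropositionalEquality using (_≢_; refl; sym; trans; cong; cong₂; subst; module ≡-Reasoning)
open import Algebra.Definitions.RawSemiring 𝔼-rawSemiring using (Irreducible) renaming (_∣_ to _∣ᴱ_)
open Irreducible

N : 𝔼 → ℤ
N (a + b ω) = a * a + a * b + b * b

N-* : ∀ u v → N (u *ᴱ v) ≡ N u * N v
N-* (a + b ω) (c + d ω) = multiplicative a b c d
  where
  multiplicative : ∀ a b c d → let x = a * c - b * d ; y = a * d + b * c + b * d in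
    x * x + x * y + y * y ≡ (a * a + a * b + b * b) * (c * c + c * d + d * d)
  multiplicative = solve-∀

unit⇒∣N∣≡1 : ∀ u → u ∣ᴱ 1ᴱ → ∣ N u ∣ ≡ 1
unit⇒∣N∣≡1 u record { quotient = q ; equality = qu≡1 } =
  ℕP.m*n≡1⇒n≡1 ∣ N q ∣ ∣ N u ∣
    (trans (sym (ℤP.abs-* (N q) (N u))) (cong ∣_∣ (trans (sym (N-* q u)) (cong N qu≡1))))

prime-factorisation : ∀ {π β γ} → EisensteinPrime π → π ≡ β *ᴱ γ →
                      ∣ N β ∣ ≡ 1 ⊎ ∣ N γ ∣ ≡ 1
prime-factorisation {β = β} {γ} irr π≡βγ =
  Sum.map (unit⇒∣N∣≡1 β) (unit⇒∣N∣≡1 γ) (split-∣1 irr π≡βγ)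

four-N : ∀ a b → + 4 * N (a + b ω) ≡
         + (∣ + 2 * a + b ∣ ℕ.* ∣ + 2 * a + b ∣ ℕ.+ 3 ℕ.* (∣ b ∣ ℕ.* ∣ b ∣))
four-N a b = begin
  + 4 * N (a + b ω)                  ≡⟨ complete-square a b ⟩
  c * c + + 3 * (b * b)              ≡⟨ cong₂ (λ P Q → P + + 3 * Q) (square c) (square b) ⟩
  + (∣ c ∣ ℕ.* ∣ c ∣) + + 3 * + (∣ b ∣ ℕ.* ∣ b ∣)
    ≡⟨ cong (λ t → + (∣ c ∣ ℕ.* ∣ c ∣) + t) (sym (ℤP.pos-* 3 (∣ b ∣ ℕ.* ∣ b ∣))) ⟩
  + (∣ c ∣ ℕ.* ∣ c ∣) + + (3 ℕ.* (∣ b ∣ ℕ.* ∣ b ∣))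
    ≡⟨ sym (ℤP.pos-+ (∣ c ∣ ℕ.* ∣ c ∣) (3 ℕ.* (∣ b ∣ ℕ.* ∣ b ∣))) ⟩
  + (∣ c ∣ ℕ.* ∣ c ∣ ℕ.+ 3 ℕ.* (∣ b ∣ ℕ.* ∣ b ∣)) ∎
  where
  open ≡-Reasoning
  c : ℤ
  c = + 2 * a + b
  complete-square : ∀ a b → + 4 * (a * a + a * b + b * b) ≡ (+ 2 * a + b) * (+ 2 * a + b) + + 3 * (b * b)
  complete-square = solve-∀
  square : ∀ i → i * i ≡ + (∣ i ∣ ℕ.* ∣ i ∣)
  square (+ n)    = sym (ℤP.pos-* n n)
  square -[1+ n ] = refl

N-nonneg : ∀ z → N z ≡ + ∣ N z ∣
N-nonneg (a + b ω) = nonneg (N (a + b ω)) (four-N a b)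
  where
  nonneg : ∀ M {m} → + 4 * M ≡ + m → M ≡ + ∣ M ∣
  nonneg (+ _) _ = refl
  nonneg -[1+ _ ] ()

N≡0⇒zero : ∀ a b → N (a + b ω) ≡ + 0 → a ≡ + 0 × b ≡ + 0
N≡0⇒zero a b N≡0 = a≡0 , b≡0
  where
  square-zero : ∀ m → m ℕ.* m ≡ 0 → m ≡ 0
  square-zero m m²≡0 = Sum.reduce (ℕP.m*n≡0⇒m≡0∨n≡0 m m²≡0)
  sum≡0 : ∣ + 2 * a + b ∣ ℕ.* ∣ + 2 * a + b ∣ ℕ.+ 3 ℕ.* (∣ b ∣ ℕ.* ∣ b ∣) ≡ 0
  sum≡0 = ℤP.+-injective (trans (sym (four-N a b)) (cong (+ 4 *_) N≡0))
  b≡0 : b ≡ + 0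
  b≡0 = ℤP.∣i∣≡0⇒i≡0 (square-zero ∣ b ∣
          (ℕP.m+n≡0⇒m≡0 (∣ b ∣ ℕ.* ∣ b ∣) (ℕP.m+n≡0⇒n≡0 (∣ + 2 * a + b ∣ ℕ.* ∣ + 2 * a + b ∣) sum≡0)))
  a≡0 : a ≡ + 0
  a≡0 = Sum.reduce (ℤP.i*j≡0⇒i≡0∨j≡0 a
          (trans (sym (drop-b a)) (trans (cong (λ B → N (a + B ω)) (sym b≡0)) N≡0)))
    where
    drop-b : ∀ a → a * a + a * + 0 + + 0 * + 0 ≡ a * a
    drop-b = solve-∀

N-bound : ∀ a b s → ∣ a ∣ ℕ.≤ s → ∣ b ∣ ℕ.≤ s →
          ∣ N (a + b ω) ∣ ℕ.≤ s ℕ.* s ℕ.+ s ℕ.* s ℕ.+ s ℕ.* s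
N-bound a b s a≤s b≤s = begin
  ∣ a * a + a * b + b * b ∣                     ≤⟨ ℤP.∣i+j∣≤∣i∣+∣j∣ (a * a + a * b) (b * b) ⟩
  ∣ a * a + a * b ∣ ℕ.+ ∣ b * b ∣              ≤⟨ ℕP.+-monoˡ-≤ _ (ℤP.∣i+j∣≤∣i∣+∣j∣ (a * a) (a * b)) ⟩
  ∣ a * a ∣ ℕ.+ ∣ a * b ∣ ℕ.+ ∣ b * b ∣
    ≡⟨ cong₂ ℕ._+_ (cong₂ ℕ._+_ (ℤP.abs-* a a) (ℤP.abs-* a b)) (ℤP.abs-* b b) ⟩
  ∣ a ∣ ℕ.* ∣ a ∣ ℕ.+ ∣ a ∣ ℕ.* ∣ b ∣ ℕ.+ ∣ b ∣ ℕ.* ∣ b ∣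
    ≤⟨ ℕP.+-mono-≤ (ℕP.+-mono-≤ (ℕP.*-mono-≤ a≤s a≤s) (ℕP.*-mono-≤ a≤s b≤s)) (ℕP.*-mono-≤ b≤s b≤s) ⟩
  s ℕ.* s ℕ.+ s ℕ.* s ℕ.+ s ℕ.* s ∎
  where open ℕP.≤-Reasoning

parity : ∀ z → ∃[ k ] (z ≡ + 2 * k ⊎ z ≡ + 2 * k + + 1)
parity z with z %ℕ 2 | n%ℕd<d z 2 | a≡a%ℕn+[a/ℕn]*n z 2
... | 0 | _ | z≡ = z /ℕ 2 , inj₁ (trans z≡ (even-form (z /ℕ 2)))
  where
  even-form : ∀ k → + 0 + k * + 2 ≡ + 2 * k
  even-form = solve-∀
... | 1 | _ | z≡ = z /ℕ 2 , inj₂ (trans z≡ (odd-form (z /ℕ 2)))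
  where
  odd-form : ∀ k → + 1 + k * + 2 ≡ + 2 * k + + 1
  odd-form = solve-∀
... | suc (suc _) | s≤s (s≤s ()) | _

even≢odd : ∀ x z → + 2 * x ≢ + 2 * z + + 1
even≢odd x z 2x≡2z+1 = ℕP.even≢odd ∣ x - z ∣ 0
  (trans (sym (ℤP.abs-* (+ 2) (x - z))) (cong ∣_∣ (begin
    + 2 * (x - z)          ≡⟨ distrib x z ⟩
    + 2 * x - + 2 * z      ≡⟨ cong (_- + 2 * z) 2x≡2z+1 ⟩
    + 2 * z + + 1 - + 2 * z ≡⟨ cancel z ⟩
    + 1 ∎)))
  where
  open ≡-Reasoning
  distrib : ∀ x z → + 2 * (x - z) ≡ + 2 * x - + 2 * z
  distrib = solve-∀
  cancel : ∀ z → + 2 * z + + 1 - + 2 * z ≡ + 1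
  cancel = solve-∀

-- An even norm is divisible by 4: N(a+bω) is odd unless a and b are both even.
N-even⇒4∣ : ∀ a b X → N (a + b ω) ≡ + 2 * X → ∃[ Z ] (X ≡ + 2 * Z)
N-even⇒4∣ a b X N≡2X with parity a | parity b
... | p , inj₁ refl | q , inj₁ refl =
  p * p + p * q + q * q , ℤP.*-cancelˡ-≡ (+ 2) X _ (trans (sym N≡2X) (even-even p q))
  where
  even-even : ∀ p q → (+ 2 * p) * (+ 2 * p) + (+ 2 * p) * (+ 2 * q) + (+ 2 * q) * (+ 2 * q)
                      ≡ + 2 * (+ 2 * (p * p + p * q + q * q))
  even-even = solve-∀
... | p , inj₂ refl | q , inj₁ refl = ⊥-elim (even≢odd X (+ 2 * p * p + + 2 * p + + 2 * p * q + q + + 2 * q * q)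
      (trans (sym N≡2X) (odd-even p q)))
  where
  odd-even : ∀ p q → (+ 2 * p + + 1) * (+ 2 * p + + 1) + (+ 2 * p + + 1) * (+ 2 * q) + (+ 2 * q) * (+ 2 * q)
                     ≡ + 2 * (+ 2 * p * p + + 2 * p + + 2 * p * q + q + + 2 * q * q) + + 1
  odd-even = solve-∀
... | p , inj₁ refl | q , inj₂ refl = ⊥-elim (even≢odd X (+ 2 * p * p + + 2 * p * q + p + + 2 * q * q + + 2 * q)
      (trans (sym N≡2X) (even-odd p q)))
  where
  even-odd : ∀ p q → (+ 2 * p) * (+ 2 * p) + (+ 2 * p) * (+ 2 * q + + 1) + (+ 2 * q + + 1) * (+ 2 * q + + 1)
                     ≡ + 2 * (+ 2 * p * p + + 2 * p * q + p + + 2 * q * q + + 2 * q) + + 1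
  even-odd = solve-∀
... | p , inj₂ refl | q , inj₂ refl = ⊥-elim (even≢odd X (+ 2 * p * p + + 2 * p * q + + 2 * q * q + + 3 * p + + 3 * q + + 1)
      (trans (sym N≡2X) (odd-odd p q)))
  where
  odd-odd : ∀ p q → (+ 2 * p + + 1) * (+ 2 * p + + 1) + (+ 2 * p + + 1) * (+ 2 * q + + 1) + (+ 2 * q + + 1) * (+ 2 * q + + 1)
                    ≡ + 2 * (+ 2 * p * p + + 2 * p * q + + 2 * q * q + + 3 * p + + 3 * q + + 1) + + 1
  odd-odd = solve-∀

-- y² + y + 1 = y(y+1) + 1 is odd.
y²+y+1-odd : ∀ Y Z → Y * Y + Y + + 1 ≢ + 2 * Z
y²+y+1-odd Y Z n≡2Z with parity Y
... | k , inj₁ refl = even≢odd Z (+ 2 * k * k + k) (trans (sym n≡2Z) (even k))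
  where
  even : ∀ k → (+ 2 * k) * (+ 2 * k) + + 2 * k + + 1 ≡ + 2 * (+ 2 * k * k + k) + + 1
  even = solve-∀
... | k , inj₂ refl = even≢odd Z (+ 2 * k * k + + 3 * k + + 1) (trans (sym n≡2Z) (odd k))
  where
  odd : ∀ k → (+ 2 * k + + 1) * (+ 2 * k + + 1) + (+ 2 * k + + 1) + + 1 ≡ + 2 * (+ 2 * k * k + + 3 * k + + 1) + + 1
  odd = solve-∀

same-residue⇒∣- : ∀ m n d .{{_ : NonZero d}} → m %ℕ d ≡ n %ℕ d →
                  m - n ≡ + d * (m /ℕ d - n /ℕ d)
same-residue⇒∣- m n d m%d≡n%d = begin
  m - n
    ≡⟨ cong₂ _-_ (a≡a%ℕn+[a/ℕn]*n m d) (a≡a%ℕn+[a/ℕn]*n n d) ⟩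
  (+ (m %ℕ d) + m /ℕ d * + d) - (+ (n %ℕ d) + n /ℕ d * + d)
    ≡⟨ cong (λ r → (r + m /ℕ d * + d) - (+ (n %ℕ d) + n /ℕ d * + d)) (cong +_ m%d≡n%d) ⟩
  (+ (n %ℕ d) + m /ℕ d * + d) - (+ (n %ℕ d) + n /ℕ d * + d)
    ≡⟨ cancel-residue (+ (n %ℕ d)) (m /ℕ d) (n /ℕ d) (+ d) ⟩
  + d * (m /ℕ d - n /ℕ d) ∎
  where
  open ≡-Reasoning
  cancel-residue : ∀ r q₁ q₂ D → (r + q₁ * D) - (r + q₂ * D) ≡ D * (q₁ - q₂)
  cancel-residue = solve-∀

∣-∣≤ : ∀ m n s → m ℕ.≤ s → n ℕ.≤ s → ∣ + m - + n ∣ ℕ.≤ s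
∣-∣≤ m n s m≤s n≤s = subst (λ i → ∣ i ∣ ℕ.≤ s) (sym (ℤP.m-n≡m⊖n m n))
  (ℕP.≤-trans (ℤP.∣m⊝n∣≤m⊔n m n) (ℕP.⊔-lub m≤s n≤s))

record ThueSolution (y d s : ℕ) : Set where
  field
    a b w   : ℤ
    a-small : ∣ a ∣ ℕ.≤ s
    b-small : ∣ b ∣ ℕ.≤ s
    nonzero : ¬ (a ≡ + 0 × b ≡ + 0)
    a·y≡b   : a * + y - b ≡ + d * w

-- Thue's lemma: if d < (s+1)², the (s+1)² values u·y - v with u,v ∈ [0,s]
-- cannot have distinct residues mod d; two colliding pairs give a solution.
thue : ∀ y d s .{{_ : NonZero d}} → d < suc s ℕ.* suc s → ThueSolution y d s
thue y d s d<grid = record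
  { a = + u₁ - + u₂ ; b = + v₁ - + v₂ ; w = value i /ℕ d - value j /ℕ d
  ; a-small = ∣-∣≤ u₁ u₂ s (FinP.toℕ≤pred[n] (proj₁ (grid i))) (FinP.toℕ≤pred[n] (proj₁ (grid j)))
  ; b-small = ∣-∣≤ v₁ v₂ s (FinP.toℕ≤pred[n] (proj₂ (grid i))) (FinP.toℕ≤pred[n] (proj₂ (grid j)))
  ; nonzero = distinct
  ; a·y≡b = trans (difference (+ u₁) (+ u₂) (+ v₁) (+ v₂) (+ y))
                  (same-residue⇒∣- (value i) (value j) d same-residue)
  }
  where
  S : ℕ
  S = suc s
  grid : Fin (S ℕ.* S) → Fin S × Fin S
  grid = remQuot {S} S
  coords : Fin (S ℕ.* S) → ℕ × ℕ
  coords k = toℕ (proj₁ (grid k)) , toℕ (proj₂ (grid k))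
  value : Fin (S ℕ.* S) → ℤ
  value k = + proj₁ (coords k) * + y - + proj₂ (coords k)
  residue : Fin (S ℕ.* S) → Fin d
  residue k = fromℕ< (n%ℕd<d (value k) d)
  collision : ∃[ i ] ∃[ j ] (i Fin.< j × residue i ≡ residue j)
  collision = FinP.pigeonhole d<grid residue
  i j : Fin (S ℕ.* S)
  i = proj₁ collision
  j = proj₁ (proj₂ collision)
  u₁ v₁ u₂ v₂ : ℕ
  u₁ = proj₁ (coords i)
  v₁ = proj₂ (coords i)
  u₂ = proj₁ (coords j)
  v₂ = proj₂ (coords j)
  same-residue : value i %ℕ d ≡ value j %ℕ d
  same-residue = trans (sym (FinP.toℕ-fromℕ< (n%ℕd<d (value i) d)))
    (trans (cong toℕ (proj₂ (proj₂ (proj₂ collision)))) (FinP.toℕ-fromℕ< (n%ℕd<d (value j) d)))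
  difference : ∀ u₁ u₂ v₁ v₂ Y → (u₁ - u₂) * Y - (v₁ - v₂) ≡ (u₁ * Y - v₁) - (u₂ * Y - v₂)
  difference = solve-∀
  distinct : ¬ (+ u₁ - + u₂ ≡ + 0 × + v₁ - + v₂ ≡ + 0)
  distinct (a≡0 , b≡0) = FinP.<⇒≢ (proj₁ (proj₂ (proj₂ collision))) (begin
    i                               ≡⟨ sym (FinP.combine-remQuot {S} S i) ⟩
    uncurry combine (grid i)        ≡⟨ cong₂ combine (same-coord (proj₁ (grid i)) (proj₁ (grid j)) a≡0)
                                                   (same-coord (proj₂ (grid i)) (proj₂ (grid j)) b≡0) ⟩
    uncurry combine (grid j)        ≡⟨ FinP.combine-remQuot {S} S j ⟩
    j ∎)
    where
    open ≡-Reasoning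
    same-coord : ∀ (p q : Fin S) → + toℕ p - + toℕ q ≡ + 0 → p ≡ q
    same-coord p q eq = FinP.toℕ-injective (ℤP.+-injective (ℤP.i-j≡0⇒i≡j (+ toℕ p) (+ toℕ q) eq))

-- If a·y ≡ b (mod d) and y²+y+1 = d·e, then d ∣ N(a+bω), because
-- N(a+bω) ≡ a²(y²+y+1) (mod d) once b is replaced by a·y - d·w.
N-multiple : ∀ a b w Y D E → a * Y - b ≡ D * w → Y * Y + Y + + 1 ≡ D * E →
             N (a + b ω) ≡ D * (a * a * E - w * (a + + 2 * a * Y - D * w))
N-multiple a b w Y D E ay-b≡Dw n≡DE = begin
  a * a + a * b + b * b
    ≡⟨ eliminate-b a b Y ⟩
  a * a * (Y * Y + Y + + 1) - (a * Y - b) * (a + + 2 * a * Y - (a * Y - b))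
    ≡⟨ cong₂ (λ n t → a * a * n - t * (a + + 2 * a * Y - t)) n≡DE ay-b≡Dw ⟩
  a * a * (D * E) - D * w * (a + + 2 * a * Y - D * w)
    ≡⟨ factor-D a D E w Y ⟩
  D * (a * a * E - w * (a + + 2 * a * Y - D * w)) ∎
  where
  open ≡-Reasoning
  eliminate-b : ∀ a b Y → a * a + a * b + b * b ≡
                a * a * (Y * Y + Y + + 1) - (a * Y - b) * (a + + 2 * a * Y - (a * Y - b))
  eliminate-b = solve-∀
  factor-D : ∀ a D E w Y → a * a * (D * E) - D * w * (a + + 2 * a * Y - D * w)
             ≡ D * (a * a * E - w * (a + + 2 * a * Y - D * w))
  factor-D = solve-∀

-- If moreover N(a+bω) = d, then a + bω divides 1 + yω with an explicit cofactor;
-- both coordinates of the product are checked after multiplying by d.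
divisor-factor : ∀ a b w Y D E .{{_ : ℤ.NonZero D}} →
                 a * Y - b ≡ D * w → Y * Y + Y + + 1 ≡ D * E → N (a + b ω) ≡ D →
                 (+ 1) + Y ω ≡ (a + b ω) *ᴱ ((a * E - w * (+ 1 + Y)) + w ω)
divisor-factor a b w Y D E ay-b≡Dw n≡DE N≡D = sym (cong₂ _+_ω real imaginary)
  where
  open ≡-Reasoning
  c = a * E - w * (+ 1 + Y)
  real : a * c - b * w ≡ + 1
  real = ℤP.*-cancelˡ-≡ D _ _ (begin
    D * (a * c - b * w)                                        ≡⟨ real-expand a b w E Y D ⟩
    a * a * (D * E) - D * w * (a + a * Y + b)                  ≡⟨ cong₂ (λ n t → a * a * n - t * (a + a * Y + b)) (sym n≡DE) (sym ay-b≡Dw) ⟩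
    a * a * (Y * Y + Y + + 1) - (a * Y - b) * (a + a * Y + b)  ≡⟨ real-collapse a b Y ⟩
    a * a + a * b + b * b                                      ≡⟨ N≡D ⟩
    D                                                          ≡⟨ sym (ℤP.*-identityʳ D) ⟩
    D * + 1 ∎)
    where
    real-expand : ∀ a b w E Y D → D * (a * (a * E - w * (+ 1 + Y)) - b * w)
                  ≡ a * a * (D * E) - D * w * (a + a * Y + b)
    real-expand = solve-∀
    real-collapse : ∀ a b Y → a * a * (Y * Y + Y + + 1) - (a * Y - b) * (a + a * Y + b)
                    ≡ a * a + a * b + b * b
    real-collapse = solve-∀
  imaginary : a * w + b * c + b * w ≡ Y
  imaginary = ℤP.*-cancelˡ-≡ D _ _ (begin
    D * (a * w + b * c + b * w)                                        ≡⟨ imaginary-expand a b w E Y D ⟩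
    a * (D * w) + a * b * (D * E) - b * (D * w) * Y                    ≡⟨ cong₂ (λ n t → a * t + a * b * n - b * t * Y) (sym n≡DE) (sym ay-b≡Dw) ⟩
    a * (a * Y - b) + a * b * (Y * Y + Y + + 1) - b * (a * Y - b) * Y  ≡⟨ imaginary-collapse a b Y ⟩
    Y * (a * a + a * b + b * b)                                        ≡⟨ cong (Y *_) N≡D ⟩
    Y * D                                                              ≡⟨ ℤP.*-comm Y D ⟩
    D * Y ∎)
    where
    imaginary-expand : ∀ a b w E Y D → D * (a * w + b * (a * E - w * (+ 1 + Y)) + b * w)
                       ≡ a * (D * w) + a * b * (D * E) - b * (D * w) * Y
    imaginary-expand = solve-∀
    imaginary-collapse : ∀ a b Y → a * (a * Y - b) + a * b * (Y * Y + Y + + 1) - b * (a * Y - b) * Y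
                         ≡ Y * (a * a + a * b + b * b)
    imaginary-collapse = solve-∀

N[1+yω] : ∀ Y → N ((+ 1) + Y ω) ≡ Y * Y + Y + + 1
N[1+yω] = reorder
  where
  reorder : ∀ Y → + 1 * + 1 + + 1 * Y + Y * Y ≡ Y * Y + Y + + 1
  reorder = solve-∀

-- If 1 + yω is prime, a divisor d > 1 of y²+y+1 with cofactor e ≠ 1 is not the
-- norm of any a + bω with a·y ≡ b (mod d): that would split 1 + yω into
-- factors of norms d and e.
norm≡divisor⇒⊥ : ∀ y d e a b w .{{_ : NonZero d}} → EisensteinPrime ((+ 1) + (+ y) ω) →
                 + y * + y + + y + + 1 ≡ + d * + e → a * + y - b ≡ + d * w →
                 N (a + b ω) ≡ + d → 1 < d → e ≢ 1 → ⊥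
norm≡divisor⇒⊥ y d e a b w π-prime n≡de ay-b≡dw Nβ≡d 1<d e≢1 =
  [ (λ ∣Nβ∣≡1 → ℕP.<⇒≢ 1<d (sym (trans (sym (cong ∣_∣ Nβ≡d)) ∣Nβ∣≡1)))
  , (λ ∣Nγ∣≡1 → e≢1 (trans (sym (cong ∣_∣ Nγ≡e)) ∣Nγ∣≡1)) ]
  (prime-factorisation {β = β} {γ} π-prime factorisation)
  where
  open ≡-Reasoning
  β γ : 𝔼
  β = a + b ω
  γ = (a * + e - w * (+ 1 + + y)) + w ω
  factorisation : (+ 1) + (+ y) ω ≡ β *ᴱ γ
  factorisation = divisor-factor a b w (+ y) (+ d) (+ e) ay-b≡dw n≡de Nβ≡d
  Nγ≡e : N γ ≡ + e
  Nγ≡e = ℤP.*-cancelˡ-≡ (+ d) _ _ (begin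
    + d * N γ                ≡⟨ cong (_* N γ) (sym Nβ≡d) ⟩
    N β * N γ                ≡⟨ sym (N-* β γ) ⟩
    N (β *ᴱ γ)               ≡⟨ cong N (sym factorisation) ⟩
    N ((+ 1) + (+ y) ω)      ≡⟨ N[1+yω] (+ y) ⟩
    + y * + y + + y + + 1    ≡⟨ n≡de ⟩
    + d * + e ∎)

-- Nor can a divisor d of y²+y+1 have N(a+bω) = 2d: then 4 ∣ 2d, so d and
-- hence y²+y+1 would be even.
norm≡2·divisor⇒⊥ : ∀ y d e a b → + y * + y + + y + + 1 ≡ + d * + e →
                   N (a + b ω) ≡ + 2 * + d → ⊥
norm≡2·divisor⇒⊥ y d e a b n≡de N≡2d with N-even⇒4∣ a b (+ d) N≡2d
... | Z , d≡2Z = y²+y+1-odd (+ y) (Z * + e)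
  (trans n≡de (trans (cong (_* + e) d≡2Z) (ℤP.*-assoc (+ 2) Z (+ e))))

-- Key step: if 1 + yω is prime, then a divisor d > 1 of y²+y+1 lying strictly
-- between consecutive squares s² < d < (s+1)² has cofactor 1.  Thue's lemma
-- gives a+bω with d ∣ N(a+bω) and 0 < N(a+bω) < 3d, and both remaining
-- values d and 2d were excluded above.
non-square-divisor : ∀ y d s e .{{_ : NonZero d}} → EisensteinPrime ((+ 1) + (+ y) ω) →
                     1 < d → s ℕ.* s < d → d < suc s ℕ.* suc s →
                     + y * + y + + y + + 1 ≡ + d * + e → e ≢ 1 → ⊥
non-square-divisor y d s e π-prime 1<d s²<d d<[s+1]² n≡de e≢1 =
  by-quotient ∣ L ∣ ∣L∣<3 ∣L∣≢0 (trans (N-nonneg (a + b ω)) (cong +_ ∣N∣≡d·∣L∣))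
  where
  open ThueSolution (thue y d s d<[s+1]²)
  L : ℤ
  L = a * a * + e - w * (a + + 2 * a * + y - + d * w)
  ∣N∣≡d·∣L∣ : ∣ N (a + b ω) ∣ ≡ d ℕ.* ∣ L ∣
  ∣N∣≡d·∣L∣ = trans (cong ∣_∣ (N-multiple a b w (+ y) (+ d) (+ e) a·y≡b n≡de)) (ℤP.abs-* (+ d) L)
  ∣L∣<3 : ∣ L ∣ < 3
  ∣L∣<3 = ℕP.*-cancelˡ-< d ∣ L ∣ 3 (begin-strict
    d ℕ.* ∣ L ∣                       ≡⟨ sym ∣N∣≡d·∣L∣ ⟩
    ∣ N (a + b ω) ∣                   ≤⟨ N-bound a b s a-small b-small ⟩
    s ℕ.* s ℕ.+ s ℕ.* s ℕ.+ s ℕ.* s  <⟨ ℕP.+-mono-< (ℕP.+-mono-< s²<d s²<d) s²<d ⟩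
    d ℕ.+ d ℕ.+ d                     ≡⟨ ℕP.+-assoc d d d ⟩
    d ℕ.+ (d ℕ.+ d)                   ≡⟨ cong (λ t → d ℕ.+ (d ℕ.+ t)) (sym (ℕP.+-identityʳ d)) ⟩
    3 ℕ.* d                           ≡⟨ ℕP.*-comm 3 d ⟩
    d ℕ.* 3 ∎)
    where
    open ℕP.≤-Reasoning
  ∣L∣≢0 : ∣ L ∣ ≢ 0
  ∣L∣≢0 ∣L∣≡0 = nonzero (N≡0⇒zero a b (ℤP.∣i∣≡0⇒i≡0
    (trans ∣N∣≡d·∣L∣ (trans (cong (d ℕ.*_) ∣L∣≡0) (ℕP.*-zeroʳ d)))))
  by-quotient : ∀ l → l < 3 → l ≢ 0 → N (a + b ω) ≡ + (d ℕ.* l) → ⊥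
  by-quotient 0 _ l≢0 _ = l≢0 refl
  by-quotient 1 _ _ N≡d = norm≡divisor⇒⊥ y d e a b w π-prime n≡de a·y≡b
    (trans N≡d (cong +_ (ℕP.*-identityʳ d))) 1<d e≢1
  by-quotient 2 _ _ N≡2d = norm≡2·divisor⇒⊥ y d e a b n≡de
    (trans N≡2d (trans (cong +_ (ℕP.*-comm d 2)) (ℤP.pos-* 2 d)))
  by-quotient (suc (suc (suc _))) (s≤s (s≤s (s≤s ()))) _ _

floor-sqrt : ∀ d → ∃[ s ] (s ℕ.* s ℕ.≤ d × d < suc s ℕ.* suc s)
floor-sqrt zero = 0 , z≤n , s≤s z≤n
floor-sqrt (suc d) with floor-sqrt d
... | s , s²≤d , d<[s+1]² with suc d ℕ.<? suc s ℕ.* suc s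
...   | yes d+1<[s+1]² = s , ℕP.m≤n⇒m≤1+n s²≤d , d+1<[s+1]²
...   | no  d+1≮[s+1]² = suc s , ℕP.≤-reflexive (sym d+1≡[s+1]²) ,
                         subst (_< suc (suc s) ℕ.* suc (suc s)) (sym d+1≡[s+1]²)
                               (ℕP.*-mono-< (ℕP.n<1+n (suc s)) (ℕP.n<1+n (suc s)))
  where
  d+1≡[s+1]² : suc d ≡ suc s ℕ.* suc s
  d+1≡[s+1]² = ℕP.≤-antisym d<[s+1]² (ℕP.≮⇒≥ d+1≮[s+1]²)

square-root-bounds : ∀ s → 1 < s ℕ.* s → 1 < s × s < s ℕ.* s
square-root-bounds zero             ()
square-root-bounds (suc zero)       (s≤s ())
square-root-bounds s@(suc (suc _)) _ = s≤s (s≤s z≤n) , ℕP.m<m*n s s (s≤s (s≤s z≤n))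

cast-norm : ∀ y → + (y ℕ.* y ℕ.+ y ℕ.+ 1) ≡ + y * + y + + y + + 1
cast-norm y = trans (ℤP.pos-+ (y ℕ.* y ℕ.+ y) 1)
  (cong (_+ + 1) (trans (ℤP.pos-+ (y ℕ.* y) y) (cong (_+ + y) (ℤP.pos-* y y))))

-- A proper divisor
-- d > 1 of y² + y + 1 is either a square s², and then s is a smaller proper
-- divisor (strong induction), or lies strictly between two squares, which
-- non-square-divisor rules out.
prime⇒norm-prime : ∀ y → EisensteinPrime ((+ 1) + (+ y) ω) → Prime (y ℕ.* y ℕ.+ y ℕ.+ 1)
prime⇒norm-prime zero π-prime = ⊥-elim (p∤1 π-prime (record { quotient = 1ᴱ ; equality = refl }))
prime⇒norm-prime y@(suc _) π-prime =
  prime {{ℕ.n>1⇒nonTrivial 1<n}} λ where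
    (composite {d} d<n d∣n) → no-proper-divisor d d∣n (ℕ.nonTrivial⇒n>1 d) d<n
  where
  n : ℕ
  n = y ℕ.* y ℕ.+ y ℕ.+ 1
  1<n : 1 < n
  1<n = ℕP.+-mono-≤ (s≤s z≤n) (ℕP.≤-refl {1})
  ProperDivisor : ℕ → Set
  ProperDivisor d = d ∣ n → 1 < d → d < n → ⊥
  no-proper-divisor : ∀ d → ProperDivisor d
  no-proper-divisor = <-rec ProperDivisor λ d smaller d∣n → by-root d smaller d∣n (floor-sqrt d)
    where
    by-root : ∀ d → (∀ {m} → m < d → ProperDivisor m) → d ∣ n →
              ∃[ s ] (s ℕ.* s ℕ.≤ d × d < suc s ℕ.* suc s) → 1 < d → d < n → ⊥
    by-root d smaller (divides e n≡ed) (s , s²≤d , d<[s+1]²) 1<d d<n with s ℕ.* s ℕ.≟ d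
    ... | no s²≢d = non-square-divisor y d s e {{ℕ.>-nonZero (ℕP.<-trans (s≤s z≤n) 1<d)}} π-prime
          1<d (ℕP.≤∧≢⇒< s²≤d s²≢d) d<[s+1]² n≡de e≢1
      where
      n≡de : + y * + y + + y + + 1 ≡ + d * + e
      n≡de = trans (sym (cast-norm y)) (trans (cong +_ n≡ed) (trans (ℤP.pos-* e d) (ℤP.*-comm (+ e) (+ d))))
      e≢1 : e ≢ 1
      e≢1 refl = ℕP.<-irrefl (trans (sym (ℕP.*-identityˡ d)) (sym n≡ed)) d<n
    ... | yes refl with square-root-bounds s 1<d
    ...   | 1<s , s<d = smaller s<d (divides (e ℕ.* s) (trans n≡ed (sym (ℕP.*-assoc e s s)))) 1<s (ℕP.<-trans s<d d<n)

InQ⇒shape : ∀ z → InQ z → ∃[ k ] ∃[ l ] (z ≡ (+ suc k) + (+ suc l) ω)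
InQ⇒shape ((+ suc k) + (+ suc l) ω) _   = k , l , refl
InQ⇒shape ((+ zero) + _ ω) (+<+ () , _)
InQ⇒shape (-[1+ _ ] + _ ω) (() , _)
InQ⇒shape (_ + (+ zero) ω) (_ , +<+ ())
InQ⇒shape (_ + -[1+ _ ] ω) (_ , ())

sum≡2⇒both-1 : ∀ k l → suc k ℕ.+ suc l ≡ 2 → k ≡ 0 × l ≡ 0
sum≡2⇒both-1 zero    zero    _  = refl , refl
sum≡2⇒both-1 zero    (suc _) ()
sum≡2⇒both-1 (suc k) l       eq = ⊥-elim (ℕP.m+1+n≢0 k (ℕP.suc-injective (ℕP.suc-injective eq)))

Q-sum-with-real-part-2 : ∀ p q m → InQ p → InQ q → p +ᴱ q ≡ (+ 2) + (+ m) ω →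
  ∃[ y₁ ] ∃[ y₂ ] (p ≡ (+ 1) + (+ y₁) ω × q ≡ (+ 1) + (+ y₂) ω × y₁ ℕ.+ y₂ ≡ m)
Q-sum-with-real-part-2 p q m p∈Q q∈Q p+q≡ with InQ⇒shape p p∈Q | InQ⇒shape q q∈Q
... | k , l , refl | k′ , l′ , refl
  with sum≡2⇒both-1 k k′ (ℤP.+-injective (cong re p+q≡))
... | refl , refl = suc l , suc l′ , refl , refl , ℤP.+-injective (cong im p+q≡)

larger-summand : ∀ N y₁ y₂ → y₁ ℕ.+ y₂ ≡ suc (suc (N ℕ.+ N)) → N < y₁ ⊎ N < y₂
larger-summand N y₁ y₂ sum≡ with N ℕ.<? y₁ | N ℕ.<? y₂
... | yes N<y₁ | _        = inj₁ N<y₁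
... | no _     | yes N<y₂ = inj₂ N<y₂
... | no N≮y₁  | no N≮y₂  = ⊥-elim (ℕP.<⇒≢
  (s≤s (ℕP.m≤n⇒m≤1+n (ℕP.+-mono-≤ (ℕP.≮⇒≥ N≮y₁) (ℕP.≮⇒≥ N≮y₂)))) sum≡)

mainTheorem10 :
    (∀ (a b : ℤ) → a > + 1 → b > + 1
      → ¬ ((a + b ω) ≡ ((+ 3) + (+ 109) ω))
      → ¬ ((a + b ω) ≡ ((+ 109) + (+ 3) ω))
      → ¬ ((a + b ω) ≡ ((+ 3) + (+ 121) ω))
      → ¬ ((a + b ω) ≡ ((+ 121) + (+ 3) ω))
      → ∃[ p ] ∃[ q ] (EisensteinPrime p × EisensteinPrime q × InQ p × InQ q
                        × (p +ᴱ q ≡ (a + b ω))))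
    → ∀ (N : ℕ) → ∃[ x ] (N < x × Prime (x Data.Nat.* x Data.Nat.+ x Data.Nat.+ 1))
mainTheorem10 goldbach N
  with goldbach (+ 2) (+ suc (suc (N ℕ.+ N))) (+<+ (s≤s (s≤s z≤n))) (+<+ (s≤s (s≤s z≤n)))
                (λ ()) (λ ()) (λ ()) (λ ())
... | p , q , p-prime , q-prime , p∈Q , q∈Q , p+q≡ with Q-sum-with-real-part-2 p q _ p∈Q q∈Q p+q≡
... | y₁ , y₂ , refl , refl , y₁+y₂≡ with larger-summand N y₁ y₂ y₁+y₂≡
... | inj₁ N<y₁ = y₁ , N<y₁ , prime⇒norm-prime y₁ p-prime
... | inj₂ N<y₂ = y₂ , N<y₂ , prime⇒norm-prime y₂ q-prime
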